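{- Let $T$ be a directed tree, i.e., a directed graph whose underlying undirected graph is a tree. Then $\operatorname{Pic}(T)$ is torsion-free, that is, $\operatorname{Jac}(T)=0$.
   Context: A directed graph $G$ has a finite nonempty vertex set $V(G)=\{v_1,\dots,v_n\}$ and a finite collection of arrows (no loops). Each arrow joins two distinct vertices and is either one-directional (from $v_i$ to $v_j$) or bi-directional (between $v_i$ and $v_j$); a bi-directional arrow counts both as an arrow from $v_i$ to $v_j$ and as an arrow from $v_j$ to $v_i$. The underlying undirected graph of $G$ has the same vertices, with an edge between $v_i,v_j$ iff $G$ has some arrow between them. The Laplacian $L_G$ is the $n\times n$ integer matrix whose $(i,i)$ entry is the number of outgoing arrows of $v_i$ and whose $(i,j)$ entry, $i\neq j$, is minus the number of arrows from $v_i$ to $v_j$. The Picard group is $\operatorname{Pic}(G)=\mathbb{Z}^n/L_G^T\mathbb{Z}^n$, and the Jacobian $\operatorname{Jac}(G)$ is its torsion subgroup. -}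

module Defs where

open import Data.Nat as ℕ using (ℕ; zero; suc)
open import Data.Integer as ℤ using (ℤ; +_; -_)
open import Data.Fin using (Fin; zero; suc; _≟_)
open import Data.Bool using (Bool; true; false; if_then_else_; _∧_; _∨_)
open import Data.List using (List; []; _∷_; length)
open import Data.List.Relation.Unary.Unique.Propositional using (Unique)
open import Data.Product using (Σ; ∃; _×_; _,_)
open import Data.Sum using (_⊎_)
open import Data.Empty using (⊥)
open import Relation.Nullary using (¬_; does)
open import Relation.Binary.PropositionalEquality using (_≡_; _≢_)

data Arrow (n : ℕ) : Set where
  oneWay : (i j : Fin n) → i ≢ j → Arrow n
  twoWay : (i j : Fin n) → i ≢ j → Arrow n

record DiGraph (n : ℕ) : Set where
  constructor digraph
  field
    arrows : List (Arrow n)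
open DiGraph public

countsFromTo : ∀ {n} → Arrow n → Fin n → Fin n → ℕ
countsFromTo (oneWay a b _) i j = if does (a ≟ i) ∧ does (b ≟ j) then 1 else 0
countsFromTo (twoWay a b _) i j =
  if (does (a ≟ i) ∧ does (b ≟ j)) ∨ (does (a ≟ j) ∧ does (b ≟ i)) then 1 else 0

arrowCount : ∀ {n} → List (Arrow n) → Fin n → Fin n → ℕ
arrowCount []       i j = 0
arrowCount (a ∷ as) i j = countsFromTo a i j ℕ.+ arrowCount as i j

joins : ∀ {n} → Arrow n → Fin n → Fin n → ℕ
joins (oneWay a b _) i j =
  if (does (a ≟ i) ∧ does (b ≟ j)) ∨ (does (a ≟ j) ∧ does (b ≟ i)) then 1 else 0
joins (twoWay a b _) i j =
  if (does (a ≟ i) ∧ does (b ≟ j)) ∨ (does (a ≟ j) ∧ does (b ≟ i)) then 1 else 0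

joinCount : ∀ {n} → List (Arrow n) → Fin n → Fin n → ℕ
joinCount []       i j = 0
joinCount (a ∷ as) i j = joins a i j ℕ.+ joinCount as i j

sumℕ : ∀ {n} → (Fin n → ℕ) → ℕ
sumℕ {zero}  f = 0
sumℕ {suc n} f = f zero ℕ.+ sumℕ (λ i → f (suc i))

sumℤ : ∀ {n} → (Fin n → ℤ) → ℤ
sumℤ {zero}  f = + 0
sumℤ {suc n} f = f zero ℤ.+ sumℤ (λ i → f (suc i))

module _ {n : ℕ} (G : DiGraph n) where

  mult : Fin n → Fin n → ℕ
  mult = arrowCount (arrows G)

  outdeg : Fin n → ℕ
  outdeg i = sumℕ (λ j → mult i j)

  Laplacian : Fin n → Fin n → ℤ
  Laplacian i j = if does (i ≟ j) then + outdeg i else - (+ mult i j)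

  LaplacianT-apply : (Fin n → ℤ) → (Fin n → ℤ)
  LaplacianT-apply y i = sumℤ (λ j → Laplacian j i ℤ.* y j)

  -- x lies in the image L_G^T ℤ^n, i.e. x = 0 in Pic(G) = ℤ^n / L_G^T ℤ^n
  InImage : (Fin n → ℤ) → Set
  InImage x = ∃ λ (y : Fin n → ℤ) → ∀ i → x i ≡ LaplacianT-apply y i

  IsTorsion : (Fin n → ℤ) → Set
  IsTorsion x = ∃ λ (m : ℤ) → m ≢ + 0 × InImage (λ i → m ℤ.* x i)

  -- Jac(G) = 0: every torsion element of Pic(G) is zero
  JacTrivial : Set
  JacTrivial = ∀ (x : Fin n → ℤ) → IsTorsion x → InImage x

  Adjacent : Fin n → Fin n → Set
  Adjacent i j = mult i j ≢ 0 ⊎ mult j i ≢ 0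

  data Walk : Fin n → Fin n → Set where
    here : ∀ {i} → Walk i i
    step : ∀ {i j k} → Adjacent i j → Walk j k → Walk i k

  Connected : Set
  Connected = ∀ i j → Walk i j

  -- Closes s c xs : c, xs₁, ..., xs_k is a walk and xs_k (or c if xs empty) is adjacent to s
  Closes : Fin n → Fin n → List (Fin n) → Set
  Closes s c []       = Adjacent c s
  Closes s c (x ∷ xs) = Adjacent c x × Closes s x xs

  IsCycle : List (Fin n) → Set
  IsCycle []         = ⊥
  IsCycle (v ∷ rest) = Unique (v ∷ rest) × 2 ℕ.≤ length rest × Closes v v rest

  Acyclic : Set
  Acyclic = ∀ (c : List (Fin n)) → ¬ IsCycle c

  NoParallelArrows : Set
  NoParallelArrows = ∀ i j → joinCount (arrows G) i j ℕ.≤ 1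

  -- G is a directed tree: its underlying undirected graph is a tree
  -- (connected, acyclic), each tree edge carrying a single arrow
  IsTree : Set
  IsTree = NoParallelArrows × Connected × Acyclic

-- Write each arrow a with ends u, v as carrying the flow φ_y(a) = y_u (one-way)
-- or y_u − y_v (two-way); then L_Gᵀ y is the boundary of φ_y, i.e. the sum of
-- φ_y(a) (e_u − e_v) over the arrows.  If m x = L_Gᵀ y with m ≠ 0, the boundary
-- of φ_y vanishes mod m at every vertex, so the arrows whose flow is not
-- divisible by m meet every vertex they touch at least twice; in a forest such
-- a set of arrows must be empty (a walk along it would close a cycle).  Hence
-- m divides every flow, φ_y = m φ_{y/m}, and cancelling m gives x = L_Gᵀ (y/m).
module Submission where

open import Defs
open import Data.Nat as ℕ using (ℕ; zero; suc; z≤n; s≤s)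
import Data.Nat.Properties as ℕP
import Data.Nat.Divisibility as ℕD
open import Data.Integer as ℤ
  using (ℤ; +_; -_; _+_; _*_; _-_; 0ℤ; 1ℤ; -1ℤ; NonZero; ≢-nonZero; _/_; _%_)
import Data.Integer.Properties as ℤP
open import Data.Integer.DivMod using (a≡a%n+[a/n]*n; n%d<d)
open import Data.Integer.Divisibility.Signed
  using (_∣_; divides; _∣?_; ∣⇒∣ᵤ; ∣m⇒∣-m; ∣m⇒∣m*n; ∣m+n∣m⇒∣n; ∣m+n∣n⇒∣m; ∣m∣n⇒∣m+n)
open import Data.Integer.Tactic.RingSolver using (solve-∀)
open import Algebra.Properties.CommutativeSemigroup ℤP.+-commutativeSemigroup using (interchange)
open import Data.Fin as Fin using (Fin; zero; suc; _≟_)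
open import Data.Fin.Properties using (any?; pigeonhole; suc-injective)
open import Data.Bool using (if_then_else_)
open import Data.List using (List; []; _∷_; length; lookup; take)
open import Data.List.Relation.Unary.All using (All; []; _∷_)
open import Data.List.Relation.Unary.All.Properties using (¬Any⇒All¬)
open import Data.List.Relation.Unary.Any using (here; there)
open import Data.List.Relation.Unary.Linked as Linked using (Linked; _∷_)
open import Data.List.Relation.Unary.AllPairs using ([]; _∷_)
open import Data.List.Relation.Unary.Unique.Propositional using (Unique)
open import Data.List.Relation.Unary.Unique.Propositional.Properties using (take⁺)
open import Data.List.Membership.Propositional using (_∈_)
open import Data.Product using (Σ; ∃; _×_; _,_)
open import Data.Sum using (_⊎_; inj₁; inj₂)
open import Data.Empty using (⊥-elim)
open import Function using (_∘_)
open import Relation.Nullary using (¬_; Dec; yes; no; does)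
open import Relation.Nullary.Decidable using (dec-true; dec-false; decidable-stable; _×-dec_; _⊎-dec_; ¬?)
open import Relation.Binary.PropositionalEquality

δ : ∀ {n} → Fin n → Fin n → ℤ
δ a i = if does (a ≟ i) then 1ℤ else 0ℤ

δ-diag : ∀ {n} (a : Fin n) → δ a a ≡ 1ℤ
δ-diag a rewrite dec-true (a ≟ a) refl = refl

δ-off : ∀ {n} {a i : Fin n} → a ≢ i → δ a i ≡ 0ℤ
δ-off {a = a} {i} a≢i rewrite dec-false (a ≟ i) a≢i = refl

δ-* : ∀ {n} (a i : Fin n) (f : Fin n → ℤ) → δ a i * f i ≡ δ a i * f a
δ-* a i f with a ≟ i
... | yes refl = refl
... | no _     = refl

sumℤ-cong : ∀ {n} {f g : Fin n → ℤ} → (∀ j → f j ≡ g j) → sumℤ f ≡ sumℤ g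
sumℤ-cong {zero}  f≗g = refl
sumℤ-cong {suc n} f≗g = cong₂ _+_ (f≗g zero) (sumℤ-cong (f≗g ∘ suc))

sumℤ-+ : ∀ {n} (f g : Fin n → ℤ) → sumℤ (λ j → f j + g j) ≡ sumℤ f + sumℤ g
sumℤ-+ {zero}  f g = refl
sumℤ-+ {suc n} f g = trans (cong (_+_ (f zero + g zero)) (sumℤ-+ (f ∘ suc) (g ∘ suc)))
                           (interchange (f zero) (g zero) (sumℤ (f ∘ suc)) (sumℤ (g ∘ suc)))

sumℤ-neg : ∀ {n} (f : Fin n → ℤ) → sumℤ (λ j → - f j) ≡ - sumℤ f
sumℤ-neg {zero}  f = refl
sumℤ-neg {suc n} f = trans (cong (_+_ (- f zero)) (sumℤ-neg (f ∘ suc)))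
                           (sym (ℤP.neg-distrib-+ (f zero) (sumℤ (f ∘ suc))))

sumℤ-minus : ∀ {n} (f g : Fin n → ℤ) → sumℤ (λ j → f j - g j) ≡ sumℤ f - sumℤ g
sumℤ-minus f g = trans (sumℤ-+ f (-_ ∘ g)) (cong (_+_ (sumℤ f)) (sumℤ-neg g))

sumℤ-zero : ∀ {n} (f : Fin n → ℤ) → (∀ j → f j ≡ 0ℤ) → sumℤ f ≡ 0ℤ
sumℤ-zero {zero}  f f≗0 = refl
sumℤ-zero {suc n} f f≗0 = cong₂ _+_ (f≗0 zero) (sumℤ-zero (f ∘ suc) (f≗0 ∘ suc))

sumℤ-single : ∀ {n} (f : Fin n → ℤ) (u : Fin n) → (∀ j → j ≢ u → f j ≡ 0ℤ) → sumℤ f ≡ f u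
sumℤ-single {suc n} f zero    off = trans (cong (_+_ (f zero)) (sumℤ-zero (f ∘ suc) (λ j → off (suc j) λ ())))
                                          (ℤP.+-identityʳ (f zero))
sumℤ-single {suc n} f (suc u) off rewrite off zero (λ ()) =
  trans (ℤP.+-identityˡ _) (sumℤ-single (f ∘ suc) u (λ j j≢u → off (suc j) (j≢u ∘ suc-injective)))

sumℤ-δ : ∀ {n} (a : Fin n) (f : Fin n → ℤ) → sumℤ (λ j → δ a j * f j) ≡ f a
sumℤ-δ a f = trans (sumℤ-single (λ j → δ a j * f j) a (λ j j≢a → cong (_* f j) (δ-off (j≢a ∘ sym))))
                   (trans (cong (_* f a) (δ-diag a)) (ℤP.*-identityˡ (f a)))

sumℕ-ℤ : ∀ {n} (f : Fin n → ℕ) → + sumℕ f ≡ sumℤ (λ j → + f j)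
sumℕ-ℤ {zero}  f = refl
sumℕ-ℤ {suc n} f = trans (ℤP.pos-+ (f zero) (sumℕ (f ∘ suc))) (cong (_+_ (+ f zero)) (sumℕ-ℤ (f ∘ suc)))

m∣i∧∣i∣<∣m∣⇒i≡0 : ∀ {m i} → m ∣ i → ℤ.∣ i ∣ ℕ.< ℤ.∣ m ∣ → i ≡ 0ℤ
m∣i∧∣i∣<∣m∣⇒i≡0 m∣i |i|<|m| = ℤP.∣i∣≡0⇒i≡0 (below (∣⇒∣ᵤ m∣i) |i|<|m|)
  where
  below : ∀ {a b} → a ℕD.∣ b → b ℕ.< a → b ≡ 0
  below {b = zero}  _   _   = refl
  below {b = suc _} a∣b b<a = ⊥-elim (ℕD.>⇒∤ b<a a∣b)

module _ (m : ℤ) .{{_ : NonZero m}} where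

  m∣a⇒a≡[a/m]*m : ∀ a → m ∣ a → a ≡ a / m * m
  m∣a⇒a≡[a/m]*m a m∣a = begin
    a                      ≡⟨ a≡a%n+[a/n]*n a m ⟩
    + (a % m) + a / m * m  ≡⟨ cong (_+ a / m * m) remainder≡0 ⟩
    0ℤ + a / m * m         ≡⟨ ℤP.+-identityˡ _ ⟩
    a / m * m              ∎
    where
    open ≡-Reasoning
    remainder≡0 : + (a % m) ≡ 0ℤ
    remainder≡0 = m∣i∧∣i∣<∣m∣⇒i≡0
      (∣m+n∣n⇒∣m (subst (m ∣_) (a≡a%n+[a/n]*n a m) m∣a) (divides (a / m) refl)) (n%d<d a m)

  m∣a-b⇒a-b≡[a/m-b/m]*m : ∀ a b → m ∣ a - b → a - b ≡ (a / m - b / m) * m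
  m∣a-b⇒a-b≡[a/m-b/m]*m a b m∣a-b = begin
    a - b                                          ≡⟨ decompose ⟩
    (+ (a % m) - + (b % m)) + (a / m - b / m) * m  ≡⟨ cong (_+ (a / m - b / m) * m) remainders≡ ⟩
    0ℤ + (a / m - b / m) * m                       ≡⟨ ℤP.+-identityˡ _ ⟩
    (a / m - b / m) * m                            ∎
    where
    open ≡-Reasoning
    regroup : ∀ r q s p k → (r + q * k) - (s + p * k) ≡ (r - s) + (q - p) * k
    regroup = solve-∀
    decompose : a - b ≡ (+ (a % m) - + (b % m)) + (a / m - b / m) * m
    decompose = trans (cong₂ _-_ (a≡a%n+[a/n]*n a m) (a≡a%n+[a/n]*n b m))
                      (regroup (+ (a % m)) (a / m) (+ (b % m)) (b / m) m)
    -- both remainders lie in [0, |m|), hence so does the absolute value of their difference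
    remainders≡ : + (a % m) - + (b % m) ≡ 0ℤ
    remainders≡ = m∣i∧∣i∣<∣m∣⇒i≡0
      (∣m+n∣n⇒∣m (subst (m ∣_) decompose m∣a-b) (divides (a / m - b / m) refl))
      (ℕP.≤-<-trans (ℕP.≤-reflexive (cong ℤ.∣_∣ (ℤP.[+m]-[+n]≡m⊖n (a % m) (b % m))))
        (ℕP.≤-<-trans (ℤP.∣m⊝n∣≤m⊔n (a % m) (b % m)) (ℕP.⊔-lub (n%d<d a m) (n%d<d b m))))

Unique⇒length≤ : ∀ {n} (xs : List (Fin n)) → Unique xs → length xs ℕ.≤ n
Unique⇒length≤ {n} xs unique with length xs ℕ.≤? n
... | yes ≤n = ≤n
... | no  ≰n with pigeonhole (ℕP.≰⇒> ≰n) (lookup xs)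
...   | i , j , i<j , xsᵢ≡xsⱼ = ⊥-elim (lookup-injective xs unique i<j xsᵢ≡xsⱼ)
  where
  lookup-injective : ∀ xs → Unique xs → ∀ {i j} → i Fin.< j → lookup xs i ≢ lookup xs j
  lookup-injective (x ∷ xs) (x∉ ∷ _) {zero} {suc j} _ = head≢ xs x∉ j
    where
    head≢ : ∀ xs → All (x ≢_) xs → ∀ j → x ≢ lookup xs j
    head≢ (_ ∷ _)  (x≢ ∷ _)   zero    = x≢
    head≢ (_ ∷ xs) (_ ∷ x∉xs) (suc j) = head≢ xs x∉xs j
  lookup-injective (x ∷ xs) (_ ∷ unique) {suc i} {suc j} (s≤s i<j) = lookup-injective xs unique i<j

module _ {n : ℕ} where

  source target : Arrow n → Fin n
  source (oneWay u v _) = u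
  source (twoWay u v _) = u
  target (oneWay u v _) = v
  target (twoWay u v _) = v

  source≢target : (a : Arrow n) → source a ≢ target a
  source≢target (oneWay _ _ u≢v) = u≢v
  source≢target (twoWay _ _ u≢v) = u≢v

  flow : (Fin n → ℤ) → Arrow n → ℤ
  flow y (oneWay u v _) = y u
  flow y (twoWay u v _) = y u - y v

  incidence : Arrow n → Fin n → ℤ
  incidence a i = δ (source a) i - δ (target a) i

  boundary : (Arrow n → ℤ) → List (Arrow n) → Fin n → ℤ
  boundary φ []       i = 0ℤ
  boundary φ (a ∷ as) i = φ a * incidence a i + boundary φ as i

  boundary-∣-term : ∀ {m} (φ : Arrow n → ℤ) as i (p : Fin (length as)) → m ∣ boundary φ as i →
                    (∀ q → q ≢ p → m ∣ φ (lookup as q) * incidence (lookup as q) i) →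
                    m ∣ φ (lookup as p) * incidence (lookup as p) i
  boundary-∣-term {m} φ (a ∷ as) i zero m∣∂ others =
    ∣m+n∣n⇒∣m m∣∂ (∣every-term⇒∣boundary as (λ q → others (suc q) λ ()))
    where
    ∣every-term⇒∣boundary : ∀ bs → (∀ q → m ∣ φ (lookup bs q) * incidence (lookup bs q) i) →
                            m ∣ boundary φ bs i
    ∣every-term⇒∣boundary []       _       = divides 0ℤ refl
    ∣every-term⇒∣boundary (b ∷ bs) m∣terms =
      ∣m∣n⇒∣m+n (m∣terms zero) (∣every-term⇒∣boundary bs (m∣terms ∘ suc))
  boundary-∣-term   φ (a ∷ as) i (suc p) m∣∂ others =
    boundary-∣-term φ as i p (∣m+n∣m⇒∣n m∣∂ (others zero λ ()))
                             (λ q q≢p → others (suc q) (q≢p ∘ suc-injective))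

  flow-quotient : ∀ m .{{_ : NonZero m}} (y : Fin n → ℤ) a → m ∣ flow y a → flow y a ≡ flow (λ j → y j / m) a * m
  flow-quotient m y (oneWay u v _) = m∣a⇒a≡[a/m]*m m (y u)
  flow-quotient m y (twoWay u v _) = m∣a-b⇒a-b≡[a/m-b/m]*m m (y u) (y v)

  boundary-flow-quotient : ∀ m .{{_ : NonZero m}} (y : Fin n → ℤ) as → (∀ q → m ∣ flow y (lookup as q)) →
                           ∀ i → boundary (flow y) as i ≡ m * boundary (flow (λ j → y j / m)) as i
  boundary-flow-quotient m y []       m∣flow i = sym (ℤP.*-zeroʳ m)
  boundary-flow-quotient m y (a ∷ as) m∣flow i = begin
    flow y a * incidence a i + boundary (flow y) as i
      ≡⟨ cong₂ (λ f r → f * incidence a i + r) (flow-quotient m y a (m∣flow zero))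
                                               (boundary-flow-quotient m y as (m∣flow ∘ suc) i) ⟩
    flow y′ a * m * incidence a i + m * boundary (flow y′) as i
      ≡⟨ factor (flow y′ a) m (incidence a i) (boundary (flow y′) as i) ⟩
    m * (flow y′ a * incidence a i + boundary (flow y′) as i) ∎
    where
    open ≡-Reasoning
    y′ : Fin n → ℤ
    y′ j = y j / m
    factor : ∀ f k e r → f * k * e + k * r ≡ k * (f * e + r)
    factor = solve-∀

  -- (L_Gᵀ y)_i for the multigraph in which c i j counts the arrows from i to j
  Lᵀ : (Fin n → Fin n → ℕ) → (Fin n → ℤ) → Fin n → ℤ
  Lᵀ c y i = sumℤ (λ j → + c i j) * y i - sumℤ (λ j → + c j i * y j)

  Lᵀ-cong : ∀ {c d} → (∀ i j → c i j ≡ d i j) → ∀ y i → Lᵀ c y i ≡ Lᵀ d y i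
  Lᵀ-cong c≗d y i = cong₂ (λ s t → s * y i - t)
    (sumℤ-cong λ j → cong +_ (c≗d i j)) (sumℤ-cong λ j → cong (λ k → + k * y j) (c≗d j i))

  Lᵀ-+ : ∀ c d y i → Lᵀ (λ i j → c i j ℕ.+ d i j) y i ≡ Lᵀ c y i + Lᵀ d y i
  Lᵀ-+ c d y i = trans (cong₂ (λ s t → s * y i - t) out in′)
    (regroup (sumℤ (λ j → + c i j)) (sumℤ (λ j → + d i j)) (y i)
             (sumℤ (λ j → + c j i * y j)) (sumℤ (λ j → + d j i * y j)))
    where
    out : sumℤ (λ j → + (c i j ℕ.+ d i j)) ≡ sumℤ (λ j → + c i j) + sumℤ (λ j → + d i j)
    out = trans (sumℤ-cong λ j → ℤP.pos-+ (c i j) (d i j)) (sumℤ-+ (λ j → + c i j) (λ j → + d i j))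
    in′ : sumℤ (λ j → + (c j i ℕ.+ d j i) * y j) ≡ sumℤ (λ j → + c j i * y j) + sumℤ (λ j → + d j i * y j)
    in′ = trans (sumℤ-cong λ j → trans (cong (_* y j) (ℤP.pos-+ (c j i) (d j i)))
                                       (ℤP.*-distribʳ-+ (y j) (+ c j i) (+ d j i)))
                (sumℤ-+ (λ j → + c j i * y j) (λ j → + d j i * y j))
    regroup : ∀ a b s t u → (a + b) * s - (t + u) ≡ (a * s - t) + (b * s - u)
    regroup = solve-∀

  countsFromTo-oneWay : ∀ (u v : Fin n) (u≢v : u ≢ v) i j → + countsFromTo (oneWay u v u≢v) i j ≡ δ u i * δ v j
  countsFromTo-oneWay u v _ i j with u ≟ i | v ≟ j
  ... | yes _ | yes _ = refl
  ... | yes _ | no _  = refl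
  ... | no _  | _     = refl

  countsFromTo-twoWay : ∀ (u v : Fin n) (u≢v : u ≢ v) i j →
    countsFromTo (twoWay u v u≢v) i j ≡ countsFromTo (oneWay u v u≢v) i j ℕ.+ countsFromTo (oneWay v u (≢-sym u≢v)) i j
  countsFromTo-twoWay u v u≢v i j with u ≟ i | v ≟ j | v ≟ i | u ≟ j
  ... | yes refl | _     | yes refl | _     = ⊥-elim (u≢v refl)
  ... | yes _    | yes _ | no _     | _     = refl
  ... | yes _    | no _  | no _     | yes _ = refl
  ... | yes _    | no _  | no _     | no _  = refl
  ... | no _     | _     | yes _    | yes _ = refl
  ... | no _     | _     | yes _    | no _  = refl
  ... | no _     | _     | no _     | yes _ = refl
  ... | no _     | _     | no _     | no _  = refl

  Lᵀ-oneWay : ∀ (u v : Fin n) (u≢v : u ≢ v) y i →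
              Lᵀ (countsFromTo (oneWay u v u≢v)) y i ≡ y u * incidence (oneWay u v u≢v) i
  Lᵀ-oneWay u v u≢v y i = begin
    sumℤ (λ j → + cnt i j) * y i - sumℤ (λ j → + cnt j i * y j)
      ≡⟨ cong₂ (λ s t → s * y i - t) out in′ ⟩
    δ u i * y i - δ v i * y u
      ≡⟨ cong (_- δ v i * y u) (δ-* u i y) ⟩
    δ u i * y u - δ v i * y u
      ≡⟨ factor (δ u i) (δ v i) (y u) ⟩
    y u * (δ u i - δ v i) ∎
    where
    open ≡-Reasoning
    cnt : Fin n → Fin n → ℕ
    cnt = countsFromTo (oneWay u v u≢v)
    out : sumℤ (λ j → + cnt i j) ≡ δ u i
    out = begin
      sumℤ (λ j → + cnt i j)      ≡⟨ sumℤ-cong (λ j → trans (countsFromTo-oneWay u v u≢v i j) (ℤP.*-comm (δ u i) (δ v j))) ⟩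
      sumℤ (λ j → δ v j * δ u i)  ≡⟨ sumℤ-δ v (λ (_ : Fin n) → δ u i) ⟩
      δ u i                       ∎
    in′ : sumℤ (λ j → + cnt j i * y j) ≡ δ v i * y u
    in′ = begin
      sumℤ (λ j → + cnt j i * y j)
        ≡⟨ sumℤ-cong (λ j → trans (cong (_* y j) (countsFromTo-oneWay u v u≢v j i)) (swap (δ u j) (δ v i) (y j))) ⟩
      sumℤ (λ j → δ u j * (δ v i * y j))
        ≡⟨ sumℤ-δ u (λ j → δ v i * y j) ⟩
      δ v i * y u ∎
      where swap : ∀ a b c → a * b * c ≡ a * (b * c)
            swap = solve-∀
    factor : ∀ a b c → a * c - b * c ≡ c * (a - b)
    factor = solve-∀

  Lᵀ-arrow : ∀ a y i → Lᵀ (countsFromTo a) y i ≡ flow y a * incidence a i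
  Lᵀ-arrow (oneWay u v u≢v) y i = Lᵀ-oneWay u v u≢v y i
  Lᵀ-arrow (twoWay u v u≢v) y i = begin
    Lᵀ (countsFromTo (twoWay u v u≢v)) y i
      ≡⟨ Lᵀ-cong (countsFromTo-twoWay u v u≢v) y i ⟩
    Lᵀ (λ i j → countsFromTo (oneWay u v u≢v) i j ℕ.+ countsFromTo (oneWay v u (≢-sym u≢v)) i j) y i
      ≡⟨ Lᵀ-+ (countsFromTo (oneWay u v u≢v)) (countsFromTo (oneWay v u (≢-sym u≢v))) y i ⟩
    Lᵀ (countsFromTo (oneWay u v u≢v)) y i + Lᵀ (countsFromTo (oneWay v u (≢-sym u≢v))) y i
      ≡⟨ cong₂ _+_ (Lᵀ-oneWay u v u≢v y i) (Lᵀ-oneWay v u (≢-sym u≢v) y i) ⟩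
    y u * (δ u i - δ v i) + y v * (δ v i - δ u i)
      ≡⟨ antisymmetric (y u) (y v) (δ u i) (δ v i) ⟩
    (y u - y v) * (δ u i - δ v i) ∎
    where
    open ≡-Reasoning
    antisymmetric : ∀ a b s t → a * (s - t) + b * (t - s) ≡ (a - b) * (s - t)
    antisymmetric = solve-∀

  Lᵀ-arrowCount : ∀ as y i → Lᵀ (arrowCount as) y i ≡ boundary (flow y) as i
  Lᵀ-arrowCount []       y i rewrite sumℤ-zero (λ (j : Fin n) → 0ℤ) (λ _ → refl) = refl
  Lᵀ-arrowCount (a ∷ as) y i =
    trans (Lᵀ-+ (countsFromTo a) (arrowCount as) y i) (cong₂ _+_ (Lᵀ-arrow a y i) (Lᵀ-arrowCount as y i))

  countsFromTo-diag : ∀ a (i : Fin n) → countsFromTo a i i ≡ 0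
  countsFromTo-diag (oneWay u v u≢v) i with u ≟ i
  ... | no _     = refl
  ... | yes refl rewrite dec-false (v ≟ u) (≢-sym u≢v) = refl
  countsFromTo-diag (twoWay u v u≢v) i with u ≟ i
  ... | no _     = refl
  ... | yes refl rewrite dec-false (v ≟ u) (≢-sym u≢v) = refl

  arrowCount-diag : ∀ as (i : Fin n) → arrowCount as i i ≡ 0
  arrowCount-diag []       i = refl
  arrowCount-diag (a ∷ as) i rewrite countsFromTo-diag a i = arrowCount-diag as i

  LaplacianT-apply≡boundary-flow : (G : DiGraph n) (y : Fin n → ℤ) (i : Fin n) →
                                   LaplacianT-apply G y i ≡ boundary (flow y) (arrows G) i
  LaplacianT-apply≡boundary-flow G y i = begin
    sumℤ (λ j → Laplacian G j i * y j)
      ≡⟨ sumℤ-cong (λ j → sym (add-sub (Laplacian G j i * y j) (inflow j))) ⟩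
    sumℤ (λ j → diagonal j - inflow j)
      ≡⟨ sumℤ-minus diagonal inflow ⟩
    sumℤ diagonal - sumℤ inflow
      ≡⟨ cong (_- sumℤ inflow) (sumℤ-single diagonal i off-diagonal) ⟩
    diagonal i - sumℤ inflow
      ≡⟨ cong (_- sumℤ inflow) on-diagonal ⟩
    + outdeg G i * y i - sumℤ inflow
      ≡⟨ cong (λ s → s * y i - sumℤ inflow) (sumℕ-ℤ (mult G i)) ⟩
    Lᵀ (mult G) y i
      ≡⟨ Lᵀ-arrowCount (arrows G) y i ⟩
    boundary (flow y) (arrows G) i ∎
    where
    open ≡-Reasoning
    inflow diagonal : Fin n → ℤ
    inflow j = + mult G j i * y j
    diagonal j = Laplacian G j i * y j + inflow j
    add-sub : ∀ a b → (a + b) - b ≡ a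
    add-sub = solve-∀
    off-diagonal : ∀ j → j ≢ i → diagonal j ≡ 0ℤ
    off-diagonal j j≢i rewrite dec-false (j ≟ i) j≢i =
      trans (cong (_+ inflow j) (sym (ℤP.neg-distribˡ-* (+ mult G j i) (y j)))) (ℤP.+-inverseˡ (inflow j))
    on-diagonal : diagonal i ≡ + outdeg G i * y i
    on-diagonal rewrite dec-true (i ≟ i) refl | arrowCount-diag (arrows G) i = ℤP.+-identityʳ _

module _ {n : ℕ} where

  Incident : Arrow n → Fin n → Set
  Incident a w = source a ≡ w ⊎ target a ≡ w

  incident? : ∀ a w → Dec (Incident a w)
  incident? a w = (source a ≟ w) ⊎-dec (target a ≟ w)

  Joins : Arrow n → Fin n → Fin n → Set
  Joins a u v = (source a ≡ u × target a ≡ v) ⊎ (source a ≡ v × target a ≡ u)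

  joins-sym : ∀ a {u v} → Joins a u v → Joins a v u
  joins-sym _ (inj₁ ends) = inj₂ ends
  joins-sym _ (inj₂ ends) = inj₁ ends

  joins⇒incident : ∀ a {u v} → Joins a u v → Incident a u
  joins⇒incident _ (inj₁ (s≡u , _)) = inj₁ s≡u
  joins⇒incident _ (inj₂ (_ , t≡u)) = inj₂ t≡u

  joins⇒≢ : ∀ a {u v} → Joins a u v → u ≢ v
  joins⇒≢ a (inj₁ (refl , refl)) = source≢target a
  joins⇒≢ a (inj₂ (refl , refl)) = source≢target a ∘ sym

  opposite : Arrow n → Fin n → Fin n
  opposite a w = if does (source a ≟ w) then target a else source a

  incident⇒joins-opposite : ∀ a w → Incident a w → Joins a w (opposite a w)
  incident⇒joins-opposite a w incident with source a ≟ w | incident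
  ... | yes s≡w | _         = inj₁ (s≡w , refl)
  ... | no  s≢w | inj₁ s≡w  = ⊥-elim (s≢w s≡w)
  ... | no  _   | inj₂ t≡w  = inj₂ (refl , t≡w)

  incidence-incident : ∀ {a w} → Incident a w → incidence a w ≡ 1ℤ ⊎ incidence a w ≡ -1ℤ
  incidence-incident {a} (inj₁ refl) rewrite δ-diag (source a) | δ-off (source≢target a ∘ sym) = inj₁ refl
  incidence-incident {a} (inj₂ refl) rewrite δ-diag (target a) | δ-off (source≢target a) = inj₂ refl

  incidence-nonincident : ∀ {a w} → ¬ Incident a w → incidence a w ≡ 0ℤ
  incidence-nonincident ¬incident rewrite δ-off (¬incident ∘ inj₁) | δ-off (¬incident ∘ inj₂) = refl

  ∣*incidence⇒∣ : ∀ {m c a w} → Incident a w → m ∣ c * incidence a w → m ∣ c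
  ∣*incidence⇒∣ {m} {c} {a} {w} incident m∣ with incidence a w | incidence-incident {a = a} incident
  ... | _ | inj₁ refl = subst (m ∣_) (ℤP.*-identityʳ c) m∣
  ... | _ | inj₂ refl = subst (m ∣_) (ℤP.neg-involutive c)
                          (∣m⇒∣-m (subst (m ∣_) (trans (ℤP.*-comm c -1ℤ) (ℤP.-1*i≡-i c)) m∣))

countsFromTo-ends : ∀ {n} (a : Arrow n) → countsFromTo a (source a) (target a) ≡ 1
countsFromTo-ends (oneWay u v _) rewrite dec-true (u ≟ u) refl | dec-true (v ≟ v) refl = refl
countsFromTo-ends (twoWay u v _) rewrite dec-true (u ≟ u) refl | dec-true (v ≟ v) refl = refl

countsFromTo≤arrowCount : ∀ {n} as (q : Fin (length as)) (u v : Fin n) →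
                          countsFromTo (lookup as q) u v ℕ.≤ arrowCount as u v
countsFromTo≤arrowCount (a ∷ as) zero    u v = ℕP.m≤m+n _ _
countsFromTo≤arrowCount (a ∷ as) (suc q) u v = ℕP.m≤n⇒m≤o+n _ (countsFromTo≤arrowCount as q u v)

joins-ends : ∀ {n} (a : Arrow n) {u v} → Joins a u v → joins a u v ≡ 1
joins-ends (oneWay s t _)   (inj₁ (refl , refl)) rewrite dec-true (s ≟ s) refl | dec-true (t ≟ t) refl = refl
joins-ends (oneWay s t s≢t) (inj₂ (refl , refl))
  rewrite dec-true (s ≟ s) refl | dec-true (t ≟ t) refl | dec-false (s ≟ t) s≢t = refl
joins-ends (twoWay s t _)   (inj₁ (refl , refl)) rewrite dec-true (s ≟ s) refl | dec-true (t ≟ t) refl = refl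
joins-ends (twoWay s t s≢t) (inj₂ (refl , refl))
  rewrite dec-true (s ≟ s) refl | dec-true (t ≟ t) refl | dec-false (s ≟ t) s≢t = refl

joins≤joinCount : ∀ {n} as (q : Fin (length as)) (u v : Fin n) → joins (lookup as q) u v ℕ.≤ joinCount as u v
joins≤joinCount (a ∷ as) zero    u v = ℕP.m≤m+n _ _
joins≤joinCount (a ∷ as) (suc q) u v = ℕP.m≤n⇒m≤o+n _ (joins≤joinCount as q u v)

joins+joins≤joinCount : ∀ {n} as {p q : Fin (length as)} (u v : Fin n) → p ≢ q →
                        joins (lookup as p) u v ℕ.+ joins (lookup as q) u v ℕ.≤ joinCount as u v
joins+joins≤joinCount (a ∷ as) {zero}  {zero}  u v p≢q = ⊥-elim (p≢q refl)
joins+joins≤joinCount (a ∷ as) {zero}  {suc q} u v _   = ℕP.+-monoʳ-≤ (joins a u v) (joins≤joinCount as q u v)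
joins+joins≤joinCount (a ∷ as) {suc p} {zero}  u v _   =
  subst (ℕ._≤ joins a u v ℕ.+ joinCount as u v) (ℕP.+-comm (joins a u v) (joins (lookup as p) u v))
        (ℕP.+-monoʳ-≤ (joins a u v) (joins≤joinCount as p u v))
joins+joins≤joinCount (a ∷ as) {suc p} {suc q} u v p≢q =
  ℕP.m≤n⇒m≤o+n _ (joins+joins≤joinCount as u v (p≢q ∘ cong suc))

module _ {n : ℕ} (G : DiGraph n) where

  Position : Set
  Position = Fin (length (arrows G))

  arrowAt : Position → Arrow n
  arrowAt = lookup (arrows G)

  arrow⇒mult≢0 : ∀ q → mult G (source (arrowAt q)) (target (arrowAt q)) ≢ 0
  arrow⇒mult≢0 q = ℕP.m<n⇒n≢0 (ℕP.≤-trans (ℕP.≤-reflexive (sym (countsFromTo-ends (arrowAt q))))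
                                          (countsFromTo≤arrowCount (arrows G) q _ _))

  joins⇒adjacent : ∀ q {u v} → Joins (arrowAt q) u v → Adjacent G u v
  joins⇒adjacent q (inj₁ (refl , refl)) = inj₁ (arrow⇒mult≢0 q)
  joins⇒adjacent q (inj₂ (refl , refl)) = inj₂ (arrow⇒mult≢0 q)

  noParallel⇒joins-injective : NoParallelArrows G → ∀ {p q u v} →
    Joins (arrowAt p) u v → Joins (arrowAt q) u v → p ≡ q
  noParallel⇒joins-injective noParallel {p} {q} {u} {v} p-joins q-joins with p Fin.≟ q
  ... | yes p≡q = p≡q
  ... | no  p≢q = ⊥-elim (ℕP.<-irrefl refl 2≤1)
    where
    2≤1 : 2 ℕ.≤ 1
    2≤1 = subst (ℕ._≤ 1) (cong₂ ℕ._+_ (joins-ends (arrowAt p) p-joins) (joins-ends (arrowAt q) q-joins))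
                (ℕP.≤-trans (joins+joins≤joinCount (arrows G) u v p≢q) (noParallel u v))

  closes-prefix : ∀ {s b w} xs → Linked (Adjacent G) (b ∷ xs) → w ∈ xs → Adjacent G w s →
                  ∃ λ k → 1 ℕ.≤ length (take k xs) × Closes G s b (take k xs)
  closes-prefix (x ∷ xs) (b~x ∷ _)   (here refl)  w~s = 1 , s≤s z≤n , b~x , w~s
  closes-prefix (x ∷ xs) (b~x ∷ xs~) (there w∈xs) w~s with closes-prefix xs xs~ w∈xs w~s
  ... | k , _ , closes = suc k , s≤s z≤n , b~x , closes

  Leafless : (Position → Set) → Set
  Leafless S = ∀ p w → S p → Incident (arrowAt p) w → ∃ λ q → q ≢ p × Incident (arrowAt q) w × S q

  module _ (noParallel : NoParallelArrows G) (acyclic : Acyclic G)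
           (S : Position → Set) (leafless : Leafless S) where

    open import Data.List.Membership.DecPropositional (_≟_ {n}) using (_∈?_)

    -- a walk along arrows of S without repeated vertices, newest vertex first
    record Trail : Set where
      field
        tip prev   : Fin n
        rest       : List (Fin n)
        last       : Position
        last∈S     : S last
        last-joins : Joins (arrowAt last) tip prev
        unique     : Unique (tip ∷ prev ∷ rest)
        linked     : Linked (Adjacent G) (tip ∷ prev ∷ rest)

      vertices : List (Fin n)
      vertices = tip ∷ prev ∷ rest

    open Trail using (vertices)

    module _ (t : Trail) where
      open Trail t hiding (vertices)

      extend : Σ Trail λ t′ → length (vertices t′) ≡ suc (length (vertices t))
      extend with leafless last tip last∈S (joins⇒incident (arrowAt last) last-joins)
      ... | q , q≢last , q-incident , q∈S with incident⇒joins-opposite (arrowAt q) tip q-incident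
      ... | q-joins with opposite (arrowAt q) tip ∈? vertices t
      ... | yes (here next≡tip) = ⊥-elim (joins⇒≢ (arrowAt q) q-joins (sym next≡tip))
      ... | yes (there (here next≡prev)) =
        ⊥-elim (q≢last (noParallel⇒joins-injective noParallel (subst (Joins (arrowAt q) tip) next≡prev q-joins) last-joins))
      ... | yes (there (there next∈rest))
            with closes-prefix rest (Linked.tail linked) next∈rest (joins⇒adjacent q (joins-sym (arrowAt q) q-joins))
      ...   | k , 1≤length , closes =
        ⊥-elim (acyclic (tip ∷ prev ∷ take k rest) (take⁺ (2 ℕ.+ k) unique , s≤s 1≤length , Linked.head linked , closes))
      extend | q , _ , _ , q∈S | q-joins | no next∉vertices = record
        { tip        = opposite (arrowAt q) tip
        ; prev       = tip
        ; rest       = prev ∷ rest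
        ; last       = q
        ; last∈S     = q∈S
        ; last-joins = joins-sym (arrowAt q) q-joins
        ; unique     = ¬Any⇒All¬ (vertices t) next∉vertices ∷ unique
        ; linked     = joins⇒adjacent q (joins-sym (arrowAt q) q-joins) ∷ linked
        } , refl

    trail-of-length : ∀ {p} → S p → ∀ k → Σ Trail λ t → k ℕ.≤ length (vertices t)
    trail-of-length {p} p∈S zero = initial , z≤n
      where
      p-joins : Joins (arrowAt p) (target (arrowAt p)) (source (arrowAt p))
      p-joins = inj₂ (refl , refl)
      initial : Trail
      initial = record
        { tip = target (arrowAt p) ; prev = source (arrowAt p) ; rest = [] ; last = p ; last∈S = p∈S
        ; last-joins = p-joins
        ; unique = ((source≢target (arrowAt p) ∘ sym) ∷ []) ∷ [] ∷ []
        ; linked = joins⇒adjacent p p-joins ∷ Linked.[-]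
        }
    trail-of-length p∈S (suc k) with trail-of-length p∈S k
    ... | t , k≤length with extend t
    ...   | t′ , length≡ = t′ , subst (suc k ℕ.≤_) (sym length≡) (s≤s k≤length)

    leafless⇒empty : ∀ p → ¬ S p
    leafless⇒empty p p∈S with trail-of-length p∈S (suc n)
    ... | t , long = ℕP.<⇒≱ long (Unique⇒length≤ (vertices t) (Trail.unique t))

  forest-∣boundary⇒∣ : NoParallelArrows G → Acyclic G → ∀ {m} (φ : Arrow n → ℤ) →
                       (∀ w → m ∣ boundary φ (arrows G) w) → ∀ q → m ∣ φ (arrowAt q)
  forest-∣boundary⇒∣ noParallel acyclic {m} φ m∣∂φ q =
    decidable-stable (m ∣? φ (arrowAt q)) (leafless⇒empty noParallel acyclic Bad leafless q)
    where
    Bad : Position → Set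
    Bad q = ¬ m ∣ φ (arrowAt q)
    leafless : Leafless Bad
    leafless p w p-bad p-incident
      with any? (λ q → ¬? (q Fin.≟ p) ×-dec incident? (arrowAt q) w ×-dec ¬? (m ∣? φ (arrowAt q)))
    ... | yes found = found
    ... | no  none  = ⊥-elim (p-bad (∣*incidence⇒∣ {a = arrowAt p} p-incident
                        (boundary-∣-term φ (arrows G) w p (m∣∂φ w) others)))
      where
      others : ∀ q → q ≢ p → m ∣ φ (arrowAt q) * incidence (arrowAt q) w
      others q q≢p with incident? (arrowAt q) w
      ... | no ¬incident rewrite incidence-nonincident {a = arrowAt q} ¬incident | ℤP.*-zeroʳ (φ (arrowAt q)) =
        divides 0ℤ refl
      ... | yes incident with m ∣? φ (arrowAt q)
      ...   | yes m∣φ = ∣m⇒∣m*n (incidence (arrowAt q) w) m∣φ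
      ...   | no  m∤φ = ⊥-elim (none (q , q≢p , incident , m∤φ))

theorem3p2 : ∀ (k : ℕ) (T : DiGraph (suc k)) → IsTree T → JacTrivial T
theorem3p2 k T (noParallel , _ , acyclic) x (m , m≢0 , y , m*x≡Lᵀy) = y′ , x≡Lᵀy′
  where
  instance
    m-nonZero : NonZero m
    m-nonZero = ≢-nonZero m≢0
  y′ : Fin (suc k) → ℤ
  y′ j = y j / m
  m∣flow : ∀ q → m ∣ flow y (arrowAt T q)
  m∣flow = forest-∣boundary⇒∣ T noParallel acyclic (flow y) λ w →
    divides (x w) (trans (sym (LaplacianT-apply≡boundary-flow T y w)) (trans (sym (m*x≡Lᵀy w)) (ℤP.*-comm m (x w))))
  x≡Lᵀy′ : ∀ i → x i ≡ LaplacianT-apply T y′ i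
  x≡Lᵀy′ i = ℤP.*-cancelˡ-≡ m (x i) _ (begin
    m * x i                              ≡⟨ m*x≡Lᵀy i ⟩
    LaplacianT-apply T y i               ≡⟨ LaplacianT-apply≡boundary-flow T y i ⟩
    boundary (flow y) (arrows T) i       ≡⟨ boundary-flow-quotient m y (arrows T) m∣flow i ⟩
    m * boundary (flow y′) (arrows T) i  ≡⟨ cong (m *_) (LaplacianT-apply≡boundary-flow T y′ i) ⟨
    m * LaplacianT-apply T y′ i          ∎)
    where open ≡-Reasoning
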